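{- Let $G=(\mathcal{V},\mathcal{E})$ be a simple undirected graph on $\mathcal{V}=\{1,\dots,n\}$ with adjacency matrix $\mathbf{A}$, let $\mathbf{H}=\mathbf{A}+\mathbf{I}$, $\mathbf{c}\in\mathbb{R}^n$, $\mathbf{w}\in\mathbb{R}^n$ with $\mathbf{w}>\mathbf{0}$, $\ell_a,\ell_b,u_a,u_b$ nonnegative reals, and $\gamma\in\mathbb{R}$. For a cost vector $\mathbf{d}\in\mathbb{R}^n$ let $f_{\mathbf{d}}(\mathbf{x},\mathbf{y})=\mathbf{d}^{\mathsf T}(\mathbf{x}+\mathbf{y})-\gamma\mathbf{x}^{\mathsf T}\mathbf{H}\mathbf{y}$ and consider the problem of maximizing $f_{\mathbf{d}}$ over the feasible set $\{(\mathbf{x},\mathbf{y}): \mathbf{0}\le\mathbf{x}\le\mathbf{1},\ \mathbf{0}\le\mathbf{y}\le\mathbf{1},\ \ell_a\le\mathbf{w}^{\mathsf T}\mathbf{x}\le u_a,\ \ell_b\le\mathbf{w}^{\mathsf T}\mathbf{y}\le u_b\}$. Say that a feasible $(\mathbf{x},\mathbf{y})$ satisfies the first-order condition for $f_{\mathbf{d}}$ if there exist $\boldsymbol{\mu}^a\in\mathcal{M}(\mathbf{x})$, $\boldsymbol{\mu}^b\in\mathcal{M}(\mathbf{y})$, $\lambda^a\in\mathcal{L}(\mathbf{x},\ell_a,u_a)$, $\lambda^b\in\mathcal{L}(\mathbf{y},\ell_b,u_b)$ with $$\mathbf{d}-\gamma\mathbf{H}\mathbf{y}+\boldsymbol{\mu}^a+\lambda^a\mathbf{w}=\mathbf{0},\qquad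 \mathbf{d}-\gamma\mathbf{H}\mathbf{x}+\boldsymbol{\mu}^b+\lambda^b\mathbf{w}=\mathbf{0}.$$ Suppose the feasible point $(\mathbf{x},\mathbf{y})$ satisfies the first-order condition for $f_{\mathbf{c}}$ with multipliers $\boldsymbol{\mu}^a,\boldsymbol{\mu}^b,\lambda^a,\lambda^b$, and let $\epsilon>0$ be arbitrary. Then in each of the following cases, with $\tilde{\mathbf{c}}$ as indicated, $(\mathbf{x},\mathbf{y})$ does not satisfy the first-order condition for $f_{\tilde{\mathbf{c}}}$: (1) for any $i\ne j$ with $\mu^a_i=\mu^a_j=0$, $x_i<1$, $x_j>0$: $\tilde c_i=c_i+\epsilon$, $\tilde c_j=c_j-\epsilon$, $\tilde c_k=c_k$ for $k\notin\{i,j\}$; (2) if $\lambda^a=0$ and $\mathbf{w}^{\mathsf T}\mathbf{x}<u_a$, for any $i$ with $\mu^a_i=0$ and $x_i<1$: $\tilde c_i=c_i+\epsilon$, $\tilde c_k=c_k$ for $k\ne i$; (3) if $\lambda^a=0$ and $\mathbf{w}^{\mathsf T}\mathbf{x}>\ell_a$, for any $j$ with $\mu^a_j=0$ and $x_j>0$: $\tilde c_j=c_j-\epsilon$, $\tilde c_k=c_k$ for $k\ne j$.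
   Context: $a_{ij}=1$ if $(i,j)\in\mathcal{E}$, else $0$; $\mathbf{H}$ is symmetric so $\nabla_{\mathbf{x}}f_{\mathbf{d}}=(\mathbf{d}-\gamma\mathbf{H}\mathbf{y})^{\mathsf T}$ and $\nabla_{\mathbf{y}}f_{\mathbf{d}}=(\mathbf{d}-\gamma\mathbf{H}\mathbf{x})^{\mathsf T}$. For $\mathbf{z}\in\mathbb{R}^n$: $\mathcal{M}(\mathbf{z})=\{\boldsymbol{\mu}\in\mathbb{R}^n:\mu_iz_i\le\min\{\mu_i,0\}\text{ for all }1\le i\le n\}$ and $\mathcal{L}(\mathbf{z},\ell,u)=\{\lambda\in\mathbb{R}:\lambda\,\mathbf{w}^{\mathsf T}\mathbf{z}\le\min\{\lambda u,\lambda\ell\}\}$. This first-order condition is equivalent to: $\nabla_{\mathbf{x}}f_{\mathbf{d}}(\mathbf{x},\mathbf{y})(\tilde{\mathbf{x}}-\mathbf{x})+\nabla_{\mathbf{y}}f_{\mathbf{d}}(\mathbf{x},\mathbf{y})(\tilde{\mathbf{y}}-\mathbf{y})\le0$ for every feasible $(\tilde{\mathbf{x}},\tilde{\mathbf{y}})$. -}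

module Defs where

open import Level using (0ℓ)
open import Data.Nat using (ℕ; zero; suc)
open import Data.Fin using (Fin; zero; suc; _≟_)
open import Data.Bool using (Bool; true; false; if_then_else_)
open import Data.Product using (Σ; ∃; _×_; _,_)
open import Relation.Nullary using (¬_; yes; no)
open import Relation.Binary.PropositionalEquality using (_≡_)
open import Algebra.Structures using (IsCommutativeRing)
open import Relation.Binary.Structures using (IsTotalOrder)

record RealField : Set₁ where
  infixl 6 _+_ _-_
  infixl 7 _*_
  infix 8 -_
  infix 4 _≤_ _<_
  field
    ℝ   : Set
    0#  : ℝ
    1#  : ℝ
    _+_ : ℝ → ℝ → ℝ
    _*_ : ℝ → ℝ → ℝ
    -_  : ℝ → ℝ
    _≤_ : ℝ → ℝ → Set
    isCommutativeRing : IsCommutativeRing _≡_ _+_ _*_ -_ 0# 1#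
    0≢1 : ¬ (0# ≡ 1#)
    inverse : ∀ x → ¬ (x ≡ 0#) → ∃ λ y → x * y ≡ 1#
    isTotalOrder : IsTotalOrder _≡_ _≤_
    +-mono-≤ : ∀ {x y} z → x ≤ y → x + z ≤ y + z
    *-nonneg : ∀ {x y} → 0# ≤ x → 0# ≤ y → 0# ≤ x * y

  _-_ : ℝ → ℝ → ℝ
  x - y = x + (- y)

  _<_ : ℝ → ℝ → Set
  x < y = (x ≤ y) × ¬ (x ≡ y)

  IsUpperBound : (ℝ → Set) → ℝ → Set
  IsUpperBound P b = ∀ x → P x → x ≤ b

  field
    completeness : (P : ℝ → Set) → (∃ λ x → P x) → (∃ λ b → IsUpperBound P b) →
                   ∃ λ s → IsUpperBound P s × (∀ b → IsUpperBound P b → s ≤ b)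

module _ (R : RealField) where
  open RealField R

  ∑ : (n : ℕ) → (Fin n → ℝ) → ℝ
  ∑ zero    f = 0#
  ∑ (suc n) f = f zero + ∑ n (λ i → f (suc i))

  record SimpleGraph (n : ℕ) : Set where
    field
      edge      : Fin n → Fin n → Bool
      symmetric : ∀ i j → edge i j ≡ edge j i
      loopless  : ∀ i → edge i i ≡ false

  adjacency : ∀ {n} → SimpleGraph n → Fin n → Fin n → ℝ
  adjacency G i j = if SimpleGraph.edge G i j then 1# else 0#

  idMat : ∀ {n} → Fin n → Fin n → ℝ
  idMat i j with i ≟ j
  ... | yes _ = 1#
  ... | no  _ = 0#

  Hmat : ∀ {n} → SimpleGraph n → Fin n → Fin n → ℝ
  Hmat G i j = adjacency G i j + idMat i j

  dot : ∀ {n} → (Fin n → ℝ) → (Fin n → ℝ) → ℝ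
  dot {n} u v = ∑ n (λ i → u i * v i)

  matVec : ∀ {n} → (Fin n → Fin n → ℝ) → (Fin n → ℝ) → Fin n → ℝ
  matVec {n} M v i = ∑ n (λ j → M i j * v j)

  record Problem (n : ℕ) : Set where
    field
      G   : SimpleGraph n
      w   : Fin n → ℝ
      w>0 : ∀ i → 0# < w i
      ℓa ℓb ua ub : ℝ
      ℓa≥0 : 0# ≤ ℓa
      ℓb≥0 : 0# ≤ ℓb
      ua≥0 : 0# ≤ ua
      ub≥0 : 0# ≤ ub
      γ   : ℝ

  module _ {n : ℕ} (P : Problem n) where
    open Problem P

    H : Fin n → Fin n → ℝ
    H = Hmat G

    f : (d x y : Fin n → ℝ) → ℝ
    f d x y = dot d (λ i → x i + y i) - γ * dot x (matVec H y)

    Feasible : (x y : Fin n → ℝ) → Set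
    Feasible x y =
      (∀ i → (0# ≤ x i) × (x i ≤ 1#)) ×
      (∀ i → (0# ≤ y i) × (y i ≤ 1#)) ×
      (ℓa ≤ dot w x) × (dot w x ≤ ua) ×
      (ℓb ≤ dot w y) × (dot w y ≤ ub)

    InM : (z μ : Fin n → ℝ) → Set
    InM z μ = ∀ i → (μ i * z i ≤ μ i) × (μ i * z i ≤ 0#)

    InL : (z : Fin n → ℝ) (ℓ u λ' : ℝ) → Set
    InL z ℓ u λ' = (λ' * dot w z ≤ λ' * u) × (λ' * dot w z ≤ λ' * ℓ)

    FOCWith : (d x y μa μb : Fin n → ℝ) (λa λb : ℝ) → Set
    FOCWith d x y μa μb λa λb =
      InM x μa × InM y μb × InL x ℓa ua λa × InL y ℓb ub λb ×
      (∀ i → d i - γ * matVec H y i + μa i + λa * w i ≡ 0#) ×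
      (∀ i → d i - γ * matVec H x i + μb i + λb * w i ≡ 0#)

    SatisfiesFOC : (d x y : Fin n → ℝ) → Set
    SatisfiesFOC d x y =
      Σ (Fin n → ℝ) λ μa → Σ (Fin n → ℝ) λ μb → Σ ℝ λ λa → Σ ℝ λ λb →
        FOCWith d x y μa μb λa λb

module Submission where

-- Subtracting the stationarity rows of the two
-- first-order conditions (for c and for c̃) at an index where the cost
-- was raised by ε gives
--     ε + (μ̃ᵢ − μᵢ) + (λ̃ − λ) wᵢ = 0,
-- and at an index where it was lowered by ε gives
--     ε + (μⱼ − μ̃ⱼ) + (λ − λ̃) wⱼ = 0.
-- A positive number plus nonnegative terms is never zero, so raising a
-- cost whose box multiplier cannot drop (μᵢ = 0 ≤ μ̃ᵢ, since xᵢ < 1)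
-- forces λ̃ < λ, and lowering one whose box multiplier cannot rise
-- (μ̃ⱼ ≤ 0 = μⱼ, since xⱼ > 0) forces λ < λ̃.  Case (1) does both, a
-- contradiction; in cases (2)/(3) λ = 0 and the slack budget constraint
-- forces λ̃ ≥ 0 resp. λ̃ ≤ 0, contradicting the forced strict sign.

open import Defs
open import Data.Nat using (ℕ)
open import Data.Fin using (Fin)
open import Data.Product using (_×_; _,_; proj₁; proj₂)
open import Data.Sum using ([_,_]; inj₁; inj₂)
open import Data.Maybe using (nothing)
open import Relation.Nullary using (¬_)
open import Relation.Binary.PropositionalEquality
  using (_≡_; refl; sym; trans; cong; subst; subst₂; module ≡-Reasoning)
open import Algebra.Bundles using (CommutativeRing)
open import Relation.Binary.Structures using (IsTotalOrder)
open import Tactic.RingSolver.Core.AlmostCommutativeRing using (fromCommutativeRing)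
import Algebra.Properties.Ring as RingProperties
import Tactic.RingSolver.NonReflective as RingSolver

module OrderedField (R : RealField) where
  open RealField R

  commutativeRing : CommutativeRing _ _
  commutativeRing = record { isCommutativeRing = isCommutativeRing }

  open CommutativeRing commutativeRing
    using (+-identityˡ; +-identityʳ; -‿inverseˡ; -‿inverseʳ; +-comm; +-assoc; *-assoc; *-identityʳ; zeroˡ; zeroʳ)
  open IsTotalOrder isTotalOrder using (total; antisym; reflexive) renaming (trans to ≤-trans)
  open RingProperties (CommutativeRing.ring commutativeRing)
    using (-0#≈0#; -‿involutive; +-inverseˡ-unique; -‿distribˡ-*; x[y-z]≈xy-xz; [y-z]x≈yx-zx)
  -- Equality of reals is not decidable, so the solver gets no zero test;
  -- it is used only for rearrangements in which no terms cancel.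
  open RingSolver (fromCommutativeRing commutativeRing (λ _ → nothing))
    using (solve; _⊕_; _⊗_; ⊝_; _⊜_)

  -- Negation reverses the order (add −x − y to both sides).
  neg-antitone : ∀ {x y} → x ≤ y → - y ≤ - x
  neg-antitone {x} {y} x≤y = subst₂ _≤_ x-cancels y-cancels (+-mono-≤ (- x + - y) x≤y)
    where
    open ≡-Reasoning
    x-cancels : x + (- x + - y) ≡ - y
    x-cancels = begin
      x + (- x + - y)   ≡⟨ sym (+-assoc x (- x) (- y)) ⟩
      (x + - x) + - y   ≡⟨ cong (_+ - y) (-‿inverseʳ x) ⟩
      0# + - y          ≡⟨ +-identityˡ (- y) ⟩
      - y               ∎
    y-cancels : y + (- x + - y) ≡ - x
    y-cancels = begin
      y + (- x + - y)   ≡⟨ cong (y +_) (+-comm (- x) (- y)) ⟩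
      y + (- y + - x)   ≡⟨ sym (+-assoc y (- y) (- x)) ⟩
      (y + - y) + - x   ≡⟨ cong (_+ - x) (-‿inverseʳ y) ⟩
      0# + - x          ≡⟨ +-identityˡ (- x) ⟩
      - x               ∎

  nonneg⇒neg-nonpos : ∀ {a} → 0# ≤ a → - a ≤ 0#
  nonneg⇒neg-nonpos 0≤a = subst (_ ≤_) -0#≈0# (neg-antitone 0≤a)

  nonpos⇒neg-nonneg : ∀ {a} → a ≤ 0# → 0# ≤ - a
  nonpos⇒neg-nonneg a≤0 = subst (_≤ _) -0#≈0# (neg-antitone a≤0)

  neg-nonneg⇒nonpos : ∀ {a} → 0# ≤ - a → a ≤ 0#
  neg-nonneg⇒nonpos {a} 0≤-a = subst₂ _≤_ (-‿involutive a) -0#≈0# (neg-antitone 0≤-a)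

  sub-nonneg : ∀ {x y} → x ≤ y → 0# ≤ y - x
  sub-nonneg {x} {y} x≤y = subst (_≤ y - x) (-‿inverseʳ x) (+-mono-≤ (- x) x≤y)

  sub-pos : ∀ {x y} → x < y → 0# < y - x
  sub-pos {x} {y} (x≤y , x≢y) = sub-nonneg x≤y , λ 0≡y-x →
    x≢y (sym (trans (+-inverseˡ-unique y (- x) (sym 0≡y-x)) (-‿involutive x)))

  add-nonneg : ∀ {a b} → 0# ≤ a → 0# ≤ b → 0# ≤ a + b
  add-nonneg {a} {b} 0≤a 0≤b = ≤-trans 0≤b (subst (_≤ a + b) (+-identityˡ b) (+-mono-≤ b 0≤a))

  zero-product : ∀ {a b} → a * b ≡ 0# → ¬ (b ≡ 0#) → a ≡ 0#
  zero-product {a} {b} ab≡0 b≢0 with inverse b b≢0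
  ... | b⁻¹ , bb⁻¹≡1 = begin
    a              ≡⟨ sym (*-identityʳ a) ⟩
    a * 1#         ≡⟨ cong (a *_) (sym bb⁻¹≡1) ⟩
    a * (b * b⁻¹)  ≡⟨ sym (*-assoc a b b⁻¹) ⟩
    (a * b) * b⁻¹  ≡⟨ cong (_* b⁻¹) ab≡0 ⟩
    0# * b⁻¹       ≡⟨ zeroˡ b⁻¹ ⟩
    0#             ∎
    where open ≡-Reasoning

  -- A nonnegative product with a positive factor has a nonnegative
  -- cofactor: if a ≤ 0 then a * b ≤ 0, so a * b = 0 and hence a = 0.
  cancel-pos-factor : ∀ {a b} → 0# < b → 0# ≤ a * b → 0# ≤ a
  cancel-pos-factor {a} {b} (0≤b , 0≢b) 0≤ab with total 0# a
  ... | inj₁ 0≤a = 0≤a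
  ... | inj₂ a≤0 = reflexive (sym (zero-product ab≡0 (λ b≡0 → 0≢b (sym b≡0))))
    where
    ab≤0 : a * b ≤ 0#
    ab≤0 = neg-nonneg⇒nonpos
      (subst (0# ≤_) (sym (-‿distribˡ-* a b)) (*-nonneg (nonpos⇒neg-nonneg a≤0) 0≤b))
    ab≡0 : a * b ≡ 0#
    ab≡0 = antisym ab≤0 0≤ab

  factor-sign⁺ : ∀ {p a b} → a < b → p * a ≤ p * b → 0# ≤ p
  factor-sign⁺ {p} {a} {b} a<b pa≤pb =
    cancel-pos-factor (sub-pos a<b) (subst (0# ≤_) (sym (x[y-z]≈xy-xz p b a)) (sub-nonneg pa≤pb))

  factor-sign⁻ : ∀ {p a b} → b < a → p * a ≤ p * b → p ≤ 0#
  factor-sign⁻ {p} {a} {b} b<a pa≤pb = neg-nonneg⇒nonpos (factor-sign⁺ b<a -pb≤-pa)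
    where
    -pb≤-pa : - p * b ≤ - p * a
    -pb≤-pa = subst₂ _≤_ (-‿distribˡ-* p b) (-‿distribˡ-* p a) (neg-antitone pa≤pb)

  no-balance : ∀ {e m d w} → 0# < e → 0# ≤ m → 0# ≤ d → 0# ≤ w → ¬ (e + m + d * w ≡ 0#)
  no-balance {e} {m} {d} {w} (0≤e , 0≢e) 0≤m 0≤d 0≤w sum≡0 = 0≢e (antisym 0≤e e≤0)
    where
    rest-nonneg : 0# ≤ m + d * w
    rest-nonneg = add-nonneg 0≤m (*-nonneg 0≤d 0≤w)
    e≡-rest : e ≡ - (m + d * w)
    e≡-rest = +-inverseˡ-unique e (m + d * w) (trans (sym (+-assoc e m (d * w))) sum≡0)
    e≤0 : e ≤ 0#
    e≤0 = subst (_≤ 0#) (sym e≡-rest) (nonneg⇒neg-nonpos rest-nonneg)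

  -- A stationarity row at one index has the shape
  --     cost − g + (box multiplier) + (budget multiplier) * w = 0,
  -- where g does not depend on the cost.  Solving it for cost − g:
  row-solved : ∀ {c g m l w} → c - g + m + l * w ≡ 0# → c - g ≡ - (m + l * w)
  row-solved {c} {g} {m} {l} {w} row =
    +-inverseˡ-unique (c - g) (m + l * w) (trans (sym (+-assoc (c - g) m (l * w))) row)

  raised-row : ∀ {c c̃ e g m̃ m l̃ l w} → c̃ ≡ c + e →
    c̃ - g + m̃ + l̃ * w ≡ 0# → c - g + m + l * w ≡ 0# → e + (m̃ - m) + (l̃ - l) * w ≡ 0#
  raised-row {c} {c̃} {e} {g} {m̃} {m} {l̃} {l} {w} c̃≡c+e new old = begin
    e + (m̃ - m) + (l̃ - l) * w        ≡⟨ cong (e + (m̃ - m) +_) ([y-z]x≈yx-zx w l̃ l) ⟩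
    e + (m̃ - m) + (l̃ * w - l * w)    ≡⟨ regroup e m̃ m l̃ l w ⟩
    - (m + l * w) + e + m̃ + l̃ * w    ≡⟨ cong (λ t → t + e + m̃ + l̃ * w) (sym (row-solved old)) ⟩
    (c - g) + e + m̃ + l̃ * w          ≡⟨ shift-cost c e g m̃ l̃ w ⟩
    (c + e) - g + m̃ + l̃ * w          ≡⟨ cong (λ t → t - g + m̃ + l̃ * w) (sym c̃≡c+e) ⟩
    c̃ - g + m̃ + l̃ * w                ≡⟨ new ⟩
    0#                               ∎
    where
    open ≡-Reasoning
    regroup : ∀ e m̃ m l̃ l w → e + (m̃ - m) + (l̃ * w - l * w) ≡ - (m + l * w) + e + m̃ + l̃ * w
    regroup = solve 6 (λ e m̃ m l̃ l w →
      (e ⊕ (m̃ ⊕ ⊝ m) ⊕ (l̃ ⊗ w ⊕ ⊝ (l ⊗ w))) ⊜ (⊝ (m ⊕ l ⊗ w) ⊕ e ⊕ m̃ ⊕ l̃ ⊗ w)) refl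
    shift-cost : ∀ c e g m̃ l̃ w → (c - g) + e + m̃ + l̃ * w ≡ (c + e) - g + m̃ + l̃ * w
    shift-cost = solve 6 (λ c e g m̃ l̃ w →
      ((c ⊕ ⊝ g) ⊕ e ⊕ m̃ ⊕ l̃ ⊗ w) ⊜ ((c ⊕ e) ⊕ ⊝ g ⊕ m̃ ⊕ l̃ ⊗ w)) refl

  raise-lowers-price : ∀ {c c̃ e g m̃ m l̃ l w} → c̃ ≡ c + e →
    c̃ - g + m̃ + l̃ * w ≡ 0# → c - g + m + l * w ≡ 0# →
    0# < e → m ≤ m̃ → 0# ≤ w → ¬ (l ≤ l̃)
  raise-lowers-price c̃≡c+e new old 0<e m≤m̃ 0≤w l≤l̃ =
    no-balance 0<e (sub-nonneg m≤m̃) (sub-nonneg l≤l̃) 0≤w (raised-row c̃≡c+e new old)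

  -- Lowering c̃ = c − e is raising c̃ back to c, so by the previous lemma
  -- a box multiplier that does not increase forces the budget multiplier
  -- to increase strictly.
  restore-cost : ∀ {c c̃ e} → c̃ ≡ c - e → c ≡ c̃ + e
  restore-cost {c} {c̃} {e} c̃≡c-e = begin
    c                ≡⟨ sym (+-identityʳ c) ⟩
    c + 0#           ≡⟨ cong (c +_) (sym (-‿inverseˡ e)) ⟩
    c + (- e + e)    ≡⟨ sym (+-assoc c (- e) e) ⟩
    (c - e) + e      ≡⟨ cong (_+ e) (sym c̃≡c-e) ⟩
    c̃ + e            ∎
    where open ≡-Reasoning

  lower-raises-price : ∀ {c c̃ e g m̃ m l̃ l w} → c̃ ≡ c - e →
    c̃ - g + m̃ + l̃ * w ≡ 0# → c - g + m + l * w ≡ 0# →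
    0# < e → m̃ ≤ m → 0# ≤ w → ¬ (l̃ ≤ l)
  lower-raises-price c̃≡c-e new old = raise-lowers-price (restore-cost c̃≡c-e) old new

  module Slackness {n : ℕ} (P : Problem R n) where
    open Problem P

    box-multiplier-nonneg : ∀ {z μ} i → InM R P z μ → z i < 1# → 0# ≤ μ i
    box-multiplier-nonneg {z} {μ} i μ∈M zᵢ<1 =
      factor-sign⁺ zᵢ<1 (subst (μ i * z i ≤_) (sym (*-identityʳ (μ i))) (proj₁ (μ∈M i)))

    box-multiplier-nonpos : ∀ {z μ} i → InM R P z μ → 0# < z i → μ i ≤ 0#
    box-multiplier-nonpos {z} {μ} i μ∈M 0<zᵢ =
      factor-sign⁻ 0<zᵢ (subst (μ i * z i ≤_) (sym (zeroʳ (μ i))) (proj₂ (μ∈M i)))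

    budget-multiplier-nonneg : ∀ {z ℓ u λ'} → InL R P z ℓ u λ' → dot R w z < u → 0# ≤ λ'
    budget-multiplier-nonneg λ∈L wz<u = factor-sign⁺ wz<u (proj₁ λ∈L)

    budget-multiplier-nonpos : ∀ {z ℓ u λ'} → InL R P z ℓ u λ' → ℓ < dot R w z → λ' ≤ 0#
    budget-multiplier-nonpos λ∈L ℓ<wz = factor-sign⁻ ℓ<wz (proj₂ λ∈L)

-- The three cases, stated for a general pair of cost vectors c, c̃ and
-- without the hypotheses the argument does not need (i ≠ j and c̃ₖ = cₖ
-- elsewhere).
module PerturbedCosts (R : RealField) {n : ℕ} (P : Problem R n) where
  open RealField R
  open Problem P
  open OrderedField R
  open Slackness P
  open IsTotalOrder isTotalOrder using (total)

  StationaryInX : (d y μ : Fin n → ℝ) (λ' : ℝ) → Set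
  StationaryInX d y μ λ' = ∀ i → d i - γ * matVec R (H R P) y i + μ i + λ' * w i ≡ 0#

  0≤w : ∀ i → 0# ≤ w i
  0≤w i = proj₁ (w>0 i)

  above-zero : ∀ {a b} → a ≡ 0# → 0# ≤ b → a ≤ b
  above-zero a≡0 = subst (_≤ _) (sym a≡0)

  below-zero : ∀ {a b} → a ≡ 0# → b ≤ 0# → b ≤ a
  below-zero a≡0 = subst (_ ≤_) (sym a≡0)

  module _ {c c̃ x y μa : Fin n → ℝ} {λa ε : ℝ}
           (row : StationaryInX c y μa λa) (0<ε : 0# < ε) where

    -- (1) The raise at i forces λ̃ < λa, the lowering at j forces λa < λ̃.
    raise-and-lower : (i j : Fin n) → μa i ≡ 0# → μa j ≡ 0# → x i < 1# → 0# < x j →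
      c̃ i ≡ c i + ε → c̃ j ≡ c j - ε → ¬ SatisfiesFOC R P c̃ x y
    raise-and-lower i j μaᵢ≡0 μaⱼ≡0 xᵢ<1 0<xⱼ c̃ᵢ c̃ⱼ (_ , _ , λ̃ , _ , μ̃∈M , _ , _ , _ , row̃ , _) =
      [ raise-lowers-price c̃ᵢ (row̃ i) (row i) 0<ε
          (above-zero μaᵢ≡0 (box-multiplier-nonneg i μ̃∈M xᵢ<1)) (0≤w i)
      , lower-raises-price c̃ⱼ (row̃ j) (row j) 0<ε
          (below-zero μaⱼ≡0 (box-multiplier-nonpos j μ̃∈M 0<xⱼ)) (0≤w j)
      ] (total λa λ̃)

    -- (2) The raise forces λ̃ < λa = 0, but a slack upper budget bound
    -- forces λ̃ ≥ 0.
    raise-under-slack-budget : λa ≡ 0# → dot R w x < ua → (i : Fin n) → μa i ≡ 0# → x i < 1# →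
      c̃ i ≡ c i + ε → ¬ SatisfiesFOC R P c̃ x y
    raise-under-slack-budget λa≡0 wx<ua i μaᵢ≡0 xᵢ<1 c̃ᵢ (_ , _ , λ̃ , _ , μ̃∈M , _ , λ̃∈L , _ , row̃ , _) =
      raise-lowers-price c̃ᵢ (row̃ i) (row i) 0<ε
        (above-zero μaᵢ≡0 (box-multiplier-nonneg i μ̃∈M xᵢ<1)) (0≤w i)
        (above-zero λa≡0 (budget-multiplier-nonneg λ̃∈L wx<ua))

    -- (3) The lowering forces λ̃ > λa = 0, but a slack lower budget bound
    -- forces λ̃ ≤ 0.
    lower-under-slack-budget : λa ≡ 0# → ℓa < dot R w x → (j : Fin n) → μa j ≡ 0# → 0# < x j →
      c̃ j ≡ c j - ε → ¬ SatisfiesFOC R P c̃ x y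
    lower-under-slack-budget λa≡0 ℓa<wx j μaⱼ≡0 0<xⱼ c̃ⱼ (_ , _ , λ̃ , _ , μ̃∈M , _ , λ̃∈L , _ , row̃ , _) =
      lower-raises-price c̃ⱼ (row̃ j) (row j) 0<ε
        (below-zero μaⱼ≡0 (box-multiplier-nonpos j μ̃∈M 0<xⱼ)) (0≤w j)
        (below-zero λa≡0 (budget-multiplier-nonpos λ̃∈L ℓa<wx))

proposition4p1 :
    (R : RealField) → let open RealField R in
    (n : ℕ) (P : Problem R n) → let open Problem P in
    (c x y μa μb : Fin n → ℝ) (λa λb : ℝ) →
    Feasible R P x y →
    FOCWith R P c x y μa μb λa λb →
    (ε : ℝ) → 0# < ε →
    ((i j : Fin n) → ¬ (i ≡ j) → μa i ≡ 0# → μa j ≡ 0# → x i < 1# → 0# < x j →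
      (c̃ : Fin n → ℝ) → c̃ i ≡ c i + ε → c̃ j ≡ c j - ε →
      (∀ k → ¬ (k ≡ i) → ¬ (k ≡ j) → c̃ k ≡ c k) →
      ¬ SatisfiesFOC R P c̃ x y)
    ×
    (λa ≡ 0# → dot R w x < ua → (i : Fin n) → μa i ≡ 0# → x i < 1# →
      (c̃ : Fin n → ℝ) → c̃ i ≡ c i + ε → (∀ k → ¬ (k ≡ i) → c̃ k ≡ c k) →
      ¬ SatisfiesFOC R P c̃ x y)
    ×
    (λa ≡ 0# → ℓa < dot R w x → (j : Fin n) → μa j ≡ 0# → 0# < x j →
      (c̃ : Fin n → ℝ) → c̃ j ≡ c j - ε → (∀ k → ¬ (k ≡ j) → c̃ k ≡ c k) →
      ¬ SatisfiesFOC R P c̃ x y)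
proposition4p1 R n P c x y μa μb λa λb _ (_ , _ , _ , _ , row , _) ε 0<ε =
  (λ i j _ μaᵢ≡0 μaⱼ≡0 xᵢ<1 0<xⱼ c̃ c̃ᵢ c̃ⱼ _ →
     raise-and-lower {c̃ = c̃} row 0<ε i j μaᵢ≡0 μaⱼ≡0 xᵢ<1 0<xⱼ c̃ᵢ c̃ⱼ) ,
  (λ λa≡0 wx<ua i μaᵢ≡0 xᵢ<1 c̃ c̃ᵢ _ →
     raise-under-slack-budget {c̃ = c̃} row 0<ε λa≡0 wx<ua i μaᵢ≡0 xᵢ<1 c̃ᵢ) ,
  (λ λa≡0 ℓa<wx j μaⱼ≡0 0<xⱼ c̃ c̃ⱼ _ →
     lower-under-slack-budget {c̃ = c̃} row 0<ε λa≡0 ℓa<wx j μaⱼ≡0 0<xⱼ c̃ⱼ)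
  where open PerturbedCosts R P
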